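{- Let $K$ be a connected solvable linear algebraic group whose unipotent radical $V$ is abelian, and let $S$ be a maximal torus of $K$ such that $K=S\ltimes V$. Let $g\in K$ have Jordan decomposition $g=tu$ with $t\in S$, $u\in V$. (1) If $g$ is semisimple, then there is a unique $h\in S$ such that $g$ is conjugate to $h$, and the $K$-conjugacy class of $h$ is $\{vhv^{ -1}: v\in V\}$. (2) If $g$ is unipotent, then the $K$-conjugacy class of $g$ is its $S$-conjugacy class $\{sgs^{ -1}: s\in S\}$ in $V$. (3) If $g$ is neither unipotent nor semisimple, then its $K$-conjugacy class is $\{tw': w'\in C_t(u)\}$, where $C_t(u)=\{s\,((t^{ -1}vt)\,u\,v^{ -1})\,s^{ -1}: s\in S,\ v\in V\}$ is the $t$-twisted conjugacy class of $u$ in $V$.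
   Context: Work over $\mathbb{C}$. An element $g=tu$ ($t\in S$, $u\in V$) is semisimple if $u=1$ and unipotent if $t=1$; every $g\in K$ has a unique such decomposition. -}

module Defs where

open import Level using (Level; _⊔_; suc)
open import Algebra.Bundles using (Group)
open import Data.Product using (Σ; ∃; _×_; _,_)
open import Relation.Nullary using (¬_)

record IsSubgroup {c ℓ p : Level} (G : Group c ℓ) (H : Group.Carrier G → Set p)
       : Set (c ⊔ ℓ ⊔ p) where
  open Group G
  field
    resp  : ∀ {x y} → x ≈ y → H x → H y
    ε∈    : H ε
    ∙∈    : ∀ {x y} → H x → H y → H (x ∙ y)
    ⁻¹∈   : ∀ {x} → H x → H (x ⁻¹)

-- Standing hypotheses: K = S ⋉ V with S a commutative subgroup (the maximal
-- torus), V an abelian normal subgroup (the unipotent radical), K = S V and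
-- S ∩ V = 1.
record SemidirectSetup {c ℓ p : Level} (K : Group c ℓ)
       (S V : Group.Carrier K → Set p) : Set (c ⊔ ℓ ⊔ p) where
  open Group K
  field
    S-subgroup : IsSubgroup K S
    V-subgroup : IsSubgroup K V
    S-comm     : ∀ {x y} → S x → S y → x ∙ y ≈ y ∙ x
    V-comm     : ∀ {x y} → V x → V y → x ∙ y ≈ y ∙ x
    V-normal   : ∀ k {v} → V v → V (k ∙ v ∙ k ⁻¹)
    K≈SV       : ∀ g → Σ Carrier λ s → Σ Carrier λ v → S s × V v × g ≈ s ∙ v
    S∩V≈1      : ∀ {x} → S x → V x → x ≈ ε

module _ {c ℓ : Level} (K : Group c ℓ) where
  open Group K

  IsConj : Carrier → Carrier → Set (c ⊔ ℓ)
  IsConj a b = Σ Carrier λ k → b ≈ k ∙ a ∙ k ⁻¹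

  -- semisimple / unipotent relative to the Jordan decomposition g = t u
  Semisimple : (t u : Carrier) → Set ℓ
  Semisimple t u = u ≈ ε

  Unipotent : (t u : Carrier) → Set ℓ
  Unipotent t u = t ≈ ε

  TwistedClass : ∀ {p} → (S V : Carrier → Set p) → (t u w : Carrier) → Set (c ⊔ ℓ ⊔ p)
  TwistedClass S V t u w =
    Σ Carrier λ s → Σ Carrier λ v →
      S s × V v × w ≈ s ∙ ((t ⁻¹ ∙ v ∙ t) ∙ u ∙ v ⁻¹) ∙ s ⁻¹

{-# OPTIONS --safe #-}
module Submission where

open import Defs
open import Level using (Level)
open import Algebra.Bundles using (Group)
open import Data.Product using (Σ; _×_; _,_)
open import Relation.Nullary using (¬_)
open import Function.Bundles using (_⇔_; mk⇔; Equivalence)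
open import Function.Construct.Composition using (_⇔-∘_)
import Algebra.Properties.Group as GroupProperties
import Relation.Binary.Reasoning.Setoid as SetoidReasoning

-- The K-conjugates of t u are computed by splitting the conjugator as s w
-- (s ∈ S, w ∈ V): conjugating by w multiplies t u by an element of V, namely
-- t (t⁻¹ w t) u w⁻¹, and since s commutes with t, conjugating by s only moves
-- that V-factor. So the class of t u is t C_t(u). For semisimple t, an
-- S-conjugate t v must have v ∈ S ∩ V = 1, and w may be traded for s w s⁻¹;
-- for unipotent u, w commutes with u and drops out.

module Conjugation {c ℓ : Level} (G : Group c ℓ) where
  open Group G
  open GroupProperties G
  open SetoidReasoning setoid

  conj : Carrier → Carrier → Carrier
  conj k a = k ∙ a ∙ k ⁻¹

  conj-cong : ∀ {k k′ a b} → k ≈ k′ → a ≈ b → conj k a ≈ conj k′ b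
  conj-cong k≈k′ a≈b = ∙-cong (∙-cong k≈k′ a≈b) (⁻¹-cong k≈k′)

  conj-ε : ∀ a → conj ε a ≈ a
  conj-ε a = begin
    ε ∙ a ∙ ε ⁻¹ ≈⟨ ∙-cong (identityˡ a) ε⁻¹≈ε ⟩
    a ∙ ε        ≈⟨ identityʳ a ⟩
    a            ∎

  conj-∙ : ∀ x y a → conj (x ∙ y) a ≈ conj x (conj y a)
  conj-∙ x y a = begin
    (x ∙ y) ∙ a ∙ (x ∙ y) ⁻¹          ≈⟨ ∙-congˡ (⁻¹-anti-homo-∙ x y) ⟩
    ((x ∙ y) ∙ a) ∙ (y ⁻¹ ∙ x ⁻¹)     ≈⟨ ∙-congʳ (assoc x y a) ⟩
    (x ∙ (y ∙ a)) ∙ (y ⁻¹ ∙ x ⁻¹)     ≈⟨ assoc x (y ∙ a) (y ⁻¹ ∙ x ⁻¹) ⟩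
    x ∙ ((y ∙ a) ∙ (y ⁻¹ ∙ x ⁻¹))     ≈⟨ ∙-congˡ (assoc (y ∙ a) (y ⁻¹) (x ⁻¹)) ⟨
    x ∙ (y ∙ a ∙ y ⁻¹ ∙ x ⁻¹)         ≈⟨ assoc x (conj y a) (x ⁻¹) ⟨
    x ∙ conj y a ∙ x ⁻¹               ∎

  conj-comm : ∀ {x a} → x ∙ a ≈ a ∙ x → conj x a ≈ a
  conj-comm {x} {a} xa≈ax = begin
    x ∙ a ∙ x ⁻¹ ≈⟨ ∙-congʳ xa≈ax ⟩
    a ∙ x ∙ x ⁻¹ ≈⟨ //-rightDividesʳ x a ⟩
    a            ∎

  conj-absorbʳ : ∀ {x y a} → y ∙ a ≈ a ∙ y → conj (x ∙ y) a ≈ conj x a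
  conj-absorbʳ {x} {y} {a} ya≈ay = trans (conj-∙ x y a) (conj-cong refl (conj-comm ya≈ay))

  conj-absorbˡ : ∀ {x y a} → x ∙ a ≈ a ∙ x → conj (x ∙ y) a ≈ conj (conj x y) a
  conj-absorbˡ {x} {y} {a} xa≈ax = begin
    conj (x ∙ y) a         ≈⟨ conj-cong (//-rightDividesˡ x (x ∙ y)) refl ⟨
    conj (conj x y ∙ x) a  ≈⟨ conj-absorbʳ xa≈ax ⟩
    conj (conj x y) a      ∎

  conj-twisted : ∀ w t u → conj w (t ∙ u) ≈ t ∙ ((t ⁻¹ ∙ w ∙ t) ∙ u ∙ w ⁻¹)
  conj-twisted w t u = begin
    w ∙ (t ∙ u) ∙ w ⁻¹                  ≈⟨ ∙-congʳ (\\-leftDividesˡ t (w ∙ (t ∙ u))) ⟨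
    t ∙ (t ⁻¹ ∙ (w ∙ (t ∙ u))) ∙ w ⁻¹   ≈⟨ ∙-congʳ (∙-congˡ (assoc (t ⁻¹) w (t ∙ u))) ⟨
    t ∙ ((t ⁻¹ ∙ w) ∙ (t ∙ u)) ∙ w ⁻¹   ≈⟨ ∙-congʳ (∙-congˡ (assoc (t ⁻¹ ∙ w) t u)) ⟨
    t ∙ ((t ⁻¹ ∙ w ∙ t) ∙ u) ∙ w ⁻¹     ≈⟨ assoc t ((t ⁻¹ ∙ w ∙ t) ∙ u) (w ⁻¹) ⟩
    t ∙ ((t ⁻¹ ∙ w ∙ t) ∙ u ∙ w ⁻¹)     ∎

  conj-∙-commutingˡ : ∀ {s t} x → t ∙ s ≈ s ∙ t → conj s (t ∙ x) ≈ t ∙ conj s x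
  conj-∙-commutingˡ {s} {t} x ts≈st = begin
    s ∙ (t ∙ x) ∙ s ⁻¹  ≈⟨ ∙-congʳ (assoc s t x) ⟨
    (s ∙ t) ∙ x ∙ s ⁻¹  ≈⟨ ∙-congʳ (∙-congʳ ts≈st) ⟨
    (t ∙ s) ∙ x ∙ s ⁻¹  ≈⟨ ∙-congʳ (assoc t s x) ⟩
    t ∙ (s ∙ x) ∙ s ⁻¹  ≈⟨ assoc t (s ∙ x) (s ⁻¹) ⟩
    t ∙ conj s x        ∎

  IsConj-refl : ∀ a → IsConj G a a
  IsConj-refl a = ε , sym (conj-ε a)

  IsConj-respˡ : ∀ {a b x} → a ≈ b → IsConj G a x → IsConj G b x
  IsConj-respˡ a≈b (k , x≈kak⁻¹) = k , trans x≈kak⁻¹ (conj-cong refl a≈b)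

  IsConj-cong : ∀ {a b x} → a ≈ b → IsConj G a x ⇔ IsConj G b x
  IsConj-cong a≈b = mk⇔ (IsConj-respˡ a≈b) (IsConj-respˡ (sym a≈b))

module Semidirect {c ℓ p : Level} {K : Group c ℓ} {S V : Group.Carrier K → Set p}
                  (setup : SemidirectSetup K S V) where
  open Group K
  open GroupProperties K
  open SetoidReasoning setoid
  open Conjugation K
  open SemidirectSetup setup
  module SG = IsSubgroup S-subgroup
  module VG = IsSubgroup V-subgroup

  twist : (t u w : Carrier) → Carrier
  twist t u w = (t ⁻¹ ∙ w ∙ t) ∙ u ∙ w ⁻¹

  twist∈V : ∀ {t u w} → V u → V w → V (twist t u w)
  twist∈V {t} Vu Vw =
    VG.∙∈ (VG.∙∈ (VG.resp (∙-congˡ (⁻¹-involutive t)) (V-normal (t ⁻¹) Vw)) Vu) (VG.⁻¹∈ Vw)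

  TwistedClass⊆V : ∀ {t u w′} → V u → TwistedClass K S V t u w′ → V w′
  TwistedClass⊆V Vu (s , v , _ , Vv , w′≈) = VG.resp (sym w′≈) (V-normal s (twist∈V Vu Vv))

  conj-S∙V : ∀ {s t} w u → S s → S t → conj (s ∙ w) (t ∙ u) ≈ t ∙ conj s (twist t u w)
  conj-S∙V {s} {t} w u Ss St = begin
    conj (s ∙ w) (t ∙ u)      ≈⟨ conj-∙ s w (t ∙ u) ⟩
    conj s (conj w (t ∙ u))   ≈⟨ conj-cong refl (conj-twisted w t u) ⟩
    conj s (t ∙ twist t u w)  ≈⟨ conj-∙-commutingˡ (twist t u w) (S-comm St Ss) ⟩
    t ∙ conj s (twist t u w)  ∎

  conjugacyClass-S∙V : ∀ {t u} → S t → ∀ x →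
    IsConj K (t ∙ u) x ⇔ Σ Carrier λ w′ → TwistedClass K S V t u w′ × x ≈ t ∙ w′
  conjugacyClass-S∙V {t} {u} St x = mk⇔ to from
    where
    to : IsConj K (t ∙ u) x → Σ Carrier λ w′ → TwistedClass K S V t u w′ × x ≈ t ∙ w′
    to (k , x≈) with K≈SV k
    ... | s , w , Ss , Vw , k≈sw =
      conj s (twist t u w) , (s , w , Ss , Vw , refl) ,
      trans x≈ (trans (conj-cong k≈sw refl) (conj-S∙V w u Ss St))
    from : (Σ Carrier λ w′ → TwistedClass K S V t u w′ × x ≈ t ∙ w′) → IsConj K (t ∙ u) x
    from (w′ , (s , v , Ss , Vv , w′≈) , x≈) =
      s ∙ v , trans x≈ (trans (∙-congˡ w′≈) (sym (conj-S∙V v u Ss St)))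

  S∋t∙v⇒v≈ε : ∀ {t v} → S t → V v → S (t ∙ v) → v ≈ ε
  S∋t∙v⇒v≈ε {t} {v} St Vv Stv = S∩V≈1 (SG.resp (\\-leftDividesʳ t v) (SG.∙∈ (SG.⁻¹∈ St) Stv)) Vv

  conjugate∈S⇒≈t : ∀ {t u h} → S t → V u → S h → IsConj K (t ∙ u) h → h ≈ t
  conjugate∈S⇒≈t {t} {u} {h} St Vu Sh tu~h with Equivalence.to (conjugacyClass-S∙V St h) tu~h
  ... | w′ , w′∈C , h≈tw′ = begin
    h      ≈⟨ h≈tw′ ⟩
    t ∙ w′ ≈⟨ ∙-congˡ (S∋t∙v⇒v≈ε St (TwistedClass⊆V Vu w′∈C) (SG.resp h≈tw′ Sh)) ⟩
    t ∙ ε  ≈⟨ identityʳ t ⟩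
    t      ∎

  conjugacyClass-S : ∀ {a} → S a → ∀ x →
    IsConj K a x ⇔ Σ Carrier λ v → V v × x ≈ conj v a
  conjugacyClass-S {a} Sa x = mk⇔ to (λ { (v , _ , x≈) → v , x≈ })
    where
    to : IsConj K a x → Σ Carrier λ v → V v × x ≈ conj v a
    to (k , x≈) with K≈SV k
    ... | s , w , Ss , Vw , k≈sw =
      conj s w , V-normal s Vw , trans x≈ (trans (conj-cong k≈sw refl) (conj-absorbˡ (S-comm Ss Sa)))

  conjugacyClass-V : ∀ {a} → V a → ∀ x →
    IsConj K a x ⇔ Σ Carrier λ s → S s × x ≈ conj s a
  conjugacyClass-V {a} Va x = mk⇔ to (λ { (s , _ , x≈) → s , x≈ })
    where
    to : IsConj K a x → Σ Carrier λ s → S s × x ≈ conj s a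
    to (k , x≈) with K≈SV k
    ... | s , w , Ss , Vw , k≈sw =
      s , Ss , trans x≈ (trans (conj-cong k≈sw refl) (conj-absorbʳ (V-comm Vw Va)))

theorem7p2 : {c ℓ p : Level} (K : Group c ℓ) (S V : Group.Carrier K → Set p) →
    SemidirectSetup K S V →
    (g t u : Group.Carrier K) → S t → V u → Group._≈_ K g (Group._∙_ K t u) →
    (Semisimple K t u →
      Σ (Group.Carrier K) λ h → S h × IsConj K g h
        × (∀ h′ → S h′ → IsConj K g h′ → Group._≈_ K h′ h)
        × (∀ x → IsConj K h x ⇔
             Σ (Group.Carrier K) λ v → V v ×
               Group._≈_ K x (Group._∙_ K (Group._∙_ K v h) (Group._⁻¹ K v))))
    × (Unipotent K t u →
      ∀ x → IsConj K g x ⇔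
        Σ (Group.Carrier K) λ s → S s ×
          Group._≈_ K x (Group._∙_ K (Group._∙_ K s g) (Group._⁻¹ K s)))
    × (¬ Semisimple K t u → ¬ Unipotent K t u →
      ∀ x → IsConj K g x ⇔
        Σ (Group.Carrier K) λ w′ → TwistedClass K S V t u w′ ×
          Group._≈_ K x (Group._∙_ K t w′))
theorem7p2 K S V setup g t u St Vu g≈tu =
    (λ u≈ε → t , St , IsConj-respˡ (sym (g≈t u≈ε)) (IsConj-refl t)
               , (λ h′ Sh′ g~h′ → conjugate∈S⇒≈t St Vu Sh′ (IsConj-respˡ g≈tu g~h′))
               , conjugacyClass-S St)
  , (λ t≈ε → conjugacyClass-V (VG.resp (sym (g≈u t≈ε)) Vu))
  , (λ _ _ x → conjugacyClass-S∙V St x ⇔-∘ IsConj-cong g≈tu)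
  where
  open Group K
  open Conjugation K
  open Semidirect setup

  g≈t : u ≈ ε → g ≈ t
  g≈t u≈ε = trans g≈tu (trans (∙-congˡ u≈ε) (identityʳ t))

  g≈u : t ≈ ε → g ≈ u
  g≈u t≈ε = trans g≈tu (trans (∙-congʳ t≈ε) (identityˡ u))
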